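{- Let $\mathcal{Q}$ be a quasi-crystal of type $A_{n-1}$ satisfying axioms LQ1 and LQ2 and such that $\ddot\varepsilon_i(x),\ddot\varphi_i(x)\in\mathbb{Z}_{\ge0}\sqcup\{+\infty\}$ for all $x\in\mathcal{Q}$, $i\in I$. Let $i,j\in I$ and $x,y\in\mathcal{Q}$ with $\ddot e_i(x)=y$. Then: (1) If $|i-j|>1$, then $\ddot\varepsilon_j(y)=\ddot\varepsilon_j(x)$ and $\ddot\varphi_j(y)=\ddot\varphi_j(x)$. (2) If $j=i+1$, then: (a) if $\ddot\varepsilon_{i+1}(x)\ne+\infty$, then $\ddot\varepsilon_{i+1}(y)=\ddot\varepsilon_{i+1}(x)$ and $\ddot\varphi_{i+1}(y)=\ddot\varphi_{i+1}(x)-1$; (b) if $\ddot\varepsilon_{i+1}(x)=+\infty$ and $\ddot\varepsilon_i(y)>0$, then $\ddot\varepsilon_{i+1}(y)=\ddot\varepsilon_{i+1}(x)=+\infty$ and $\ddot\varphi_{i+1}(y)=\ddot\varphi_{i+1}(x)=+\infty$; (c) if $\ddot\varepsilon_{i+1}(x)=+\infty$ and $\ddot\varepsilon_i(y)=0$, then $\ddot\varepsilon_{i+1}(y)=-\langle\mathrm{wt}(y),\alpha_{i+1}\rangle>0$ and $\ddot\varphi_{i+1}(y)=0$. (3) If $j=i-1$, then: (a) if $\ddot\varphi_{i-1}(y)\ne+\infty$, then $\ddot\varepsilon_{i-1}(x)=\ddot\varepsilon_{i-1}(y)-1$ and $\ddot\varphi_{i-1}(x)=\ddot\varphi_{i-1}(y)$;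 (b) if $\ddot\varphi_{i-1}(y)=+\infty$ and $\ddot\varphi_i(x)>0$, then $\ddot\varepsilon_{i-1}(x)=\ddot\varepsilon_{i-1}(y)=+\infty$ and $\ddot\varphi_{i-1}(x)=\ddot\varphi_{i-1}(y)=+\infty$; (c) if $\ddot\varphi_{i-1}(y)=+\infty$ and $\ddot\varphi_i(x)=0$, then $\ddot\varepsilon_{i-1}(x)=0$ and $\ddot\varphi_{i-1}(x)=\langle\mathrm{wt}(x),\alpha_{i-1}\rangle>0$.
   Context: Fix $n\ge 2$, $I=\{1,\dots,n-1\}$, weights in $\mathbb{Z}^n$ with standard inner product $\langle\cdot,\cdot\rangle$, $\alpha_i=\mathbf{e}_i-\mathbf{e}_{i+1}$; on $\mathbb{Z}\sqcup\{\pm\infty\}$, $m+(\pm\infty)=\pm\infty$. A quasi-crystal of type $A_{n-1}$ is a non-empty set $\mathcal{Q}$ with maps $\ddot e_i,\ddot f_i:\mathcal{Q}\to\mathcal{Q}\sqcup\{\bot\}$, $\ddot\varepsilon_i,\ddot\varphi_i:\mathcal{Q}\to\mathbb{Z}\sqcup\{\pm\infty\}$, $\mathrm{wt}:\mathcal{Q}\to\mathbb{Z}^n$ with: (Q1) $\ddot e_i(x)=y\iff x=\ddot f_i(y)$, and then $\mathrm{wt}(y)=\mathrm{wt}(x)+\alpha_i$, $\ddot\varepsilon_i(y)=\ddot\varepsilon_i(x)-1$, $\ddot\varphi_i(y)=\ddot\varphi_i(x)+1$; (Q2) $\ddot\varphi_i(x)=\ddot\varepsilon_i(x)+\langle\mathrm{wt}(x),\alpha_i\rangle$;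 (Q3),(Q4) if $\ddot\varepsilon_i(x)=\pm\infty$ then $\ddot e_i(x)=\ddot f_i(x)=\bot$. Axioms (all $i,j\in I$, $x,y$): (LQ1) for $i+1\in I$: $\ddot\varepsilon_i(x)=0\iff\ddot\varphi_{i+1}(x)=0$. (LQ2) if $\ddot e_i(x)=y$: (1) $\ddot\varepsilon_j(x)=\ddot\varepsilon_j(y)$ for $|i-j|>1$; (2) if $i+1\in I$: $\ddot\varepsilon_{i+1}(x)\ne\ddot\varepsilon_{i+1}(y)$ iff ($\ddot\varepsilon_{i+1}(x)=+\infty$ and $\ddot\varepsilon_i(y)=0$), and then $\ddot\varepsilon_{i+1}(y)\ne0$; (3) if $i-1\in I$: $\ddot\varphi_{i-1}(x)\ne\ddot\varphi_{i-1}(y)$ iff ($\ddot\varphi_{i-1}(y)=+\infty$ and $\ddot\varphi_i(x)=0$), and then $\ddot\varphi_{i-1}(x)\ne0$. -}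

module Defs where

open import Data.Nat using (ℕ; zero; suc; pred; _≤_; _<_; _≟_)
open import Data.Nat using () renaming (∣_-_∣ to dist)
open import Data.Unit using (⊤)
open import Data.Empty using (⊥)
open import Relation.Nullary using (yes; no; ¬_)
open import Data.Integer as ℤ using (ℤ; +_; -[1+_])
open import Data.Fin as Fin using (Fin; toℕ)
open import Data.Maybe using (Maybe; just; nothing)
open import Data.Product using (_×_)
open import Relation.Binary.PropositionalEquality using (_≡_)
open import Level using (Level)

data ℤ∞ : Set where
  fin  : ℤ → ℤ∞
  +∞   : ℤ∞
  -∞   : ℤ∞

infixr 6 _⊕_
_⊕_ : ℤ → ℤ∞ → ℤ∞
m ⊕ fin k = fin (m ℤ.+ k)
m ⊕ +∞    = +∞
m ⊕ -∞    = -∞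

NonNeg∞ : ℤ∞ → Set
NonNeg∞ (fin k) = + 0 ℤ.≤ k
NonNeg∞ +∞      = ⊤
NonNeg∞ -∞      = ⊥

Pos∞ : ℤ∞ → Set
Pos∞ (fin k) = + 0 ℤ.< k
Pos∞ +∞      = ⊤
Pos∞ -∞      = ⊥

InI : ℕ → ℕ → Set
InI n i = 1 ≤ i × i < n

-- weights: ℤⁿ, coordinate k ∈ {1,…,n} stored at position k-1 of Fin n
Weight : ℕ → Set
Weight n = Fin n → ℤ

sumFin : ∀ {n} → (Fin n → ℤ) → ℤ
sumFin {zero}  f = + 0
sumFin {suc n} f = f Fin.zero ℤ.+ sumFin (λ k → f (Fin.suc k))

⟨_,_⟩ : ∀ {n} → Weight n → Weight n → ℤ
⟨ v , w ⟩ = sumFin (λ k → v k ℤ.* w k)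

_+w_ : ∀ {n} → Weight n → Weight n → Weight n
(v +w w) k = v k ℤ.+ w k

-- unit vector e_i (1-based: e_i has a 1 in coordinate i, i.e. Fin position i-1)
e : ∀ {n} → ℕ → Weight n
e i k with suc (toℕ k) ≟ i
... | yes _ = + 1
... | no _  = + 0

α : ∀ {n} → ℕ → Weight n
α i k = e i k ℤ.- e (suc i) k

-- a quasi-crystal of type A_{n-1}; ⊥ is modelled by 'nothing'.
-- Operators are indexed by ℕ; only indices i ∈ I (InI n i) are constrained/used.
record QuasiCrystal (n : ℕ) (ℓ : Level) : Set (Level.suc ℓ) where
  field
    Carrier  : Set ℓ
    nonempty : Carrier
    ë f̈      : ℕ → Carrier → Maybe Carrier
    ε̈ φ̈      : ℕ → Carrier → ℤ∞
    wt       : Carrier → Weight n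
    Q1-iff : ∀ {i} → InI n i → ∀ x y → (ë i x ≡ just y → f̈ i y ≡ just x) × (f̈ i y ≡ just x → ë i x ≡ just y)
    Q1-wt  : ∀ {i} → InI n i → ∀ x y → ë i x ≡ just y → wt y ≡ wt x +w α i
    Q1-ε   : ∀ {i} → InI n i → ∀ x y → ë i x ≡ just y → ε̈ i y ≡ -[1+ 0 ] ⊕ ε̈ i x
    Q1-φ   : ∀ {i} → InI n i → ∀ x y → ë i x ≡ just y → φ̈ i y ≡ + 1 ⊕ φ̈ i x
    Q2     : ∀ {i} → InI n i → ∀ x → φ̈ i x ≡ ⟨ wt x , α i ⟩ ⊕ ε̈ i x
    Q3     : ∀ {i} → InI n i → ∀ x → ε̈ i x ≡ +∞ → (ë i x ≡ nothing) × (f̈ i x ≡ nothing)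
    Q4     : ∀ {i} → InI n i → ∀ x → ε̈ i x ≡ -∞ → (ë i x ≡ nothing) × (f̈ i x ≡ nothing)

module _ {n : ℕ} {ℓ : Level} (Q : QuasiCrystal n ℓ) where
  open QuasiCrystal Q

  LQ1 : Set ℓ
  LQ1 = ∀ i → InI n i → InI n (suc i) → ∀ x →
        (ε̈ i x ≡ fin (+ 0) → φ̈ (suc i) x ≡ fin (+ 0)) ×
        (φ̈ (suc i) x ≡ fin (+ 0) → ε̈ i x ≡ fin (+ 0))

  LQ2 : Set ℓ
  LQ2 = ∀ i → InI n i → ∀ x y → ë i x ≡ just y →
        (∀ j → InI n j → 1 < dist i j → ε̈ j x ≡ ε̈ j y) ×
        (InI n (suc i) →
          ((¬ ε̈ (suc i) x ≡ ε̈ (suc i) y) → (ε̈ (suc i) x ≡ +∞ × ε̈ i y ≡ fin (+ 0))) ×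
          ((ε̈ (suc i) x ≡ +∞ × ε̈ i y ≡ fin (+ 0)) → ¬ ε̈ (suc i) x ≡ ε̈ (suc i) y) ×
          ((¬ ε̈ (suc i) x ≡ ε̈ (suc i) y) → ¬ ε̈ (suc i) y ≡ fin (+ 0))) ×
        (InI n (pred i) →
          ((¬ φ̈ (pred i) x ≡ φ̈ (pred i) y) → (φ̈ (pred i) y ≡ +∞ × φ̈ i x ≡ fin (+ 0))) ×
          ((φ̈ (pred i) y ≡ +∞ × φ̈ i x ≡ fin (+ 0)) → ¬ φ̈ (pred i) x ≡ φ̈ (pred i) y) ×
          ((¬ φ̈ (pred i) x ≡ φ̈ (pred i) y) → ¬ φ̈ (pred i) x ≡ fin (+ 0)))

  NonNegValued : Set ℓ
  NonNegValued = ∀ i → InI n i → ∀ x → NonNeg∞ (ε̈ i x) × NonNeg∞ (φ̈ i x)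

module Submission where

-- Along ë_i the weight moves by α_i, so the difference φ̈_j - ε̈_j = ⟨wt , α_j⟩ of (Q2)
-- changes by the Cartan entry ⟨α_i , α_j⟩, which is 0 for |i - j| > 1 and -1 for j = i ± 1.
-- LQ2 says that ε̈_{i+1} (resp. φ̈_{i-1}) is preserved outside one exceptional situation;
-- as equality on ℤ ⊔ {±∞} is decidable, excluding that situation yields the equality.
-- In the exceptional case (c), LQ1 converts the vanishing of ε̈_i y (resp. φ̈_i x) into
-- that of φ̈_{i+1} y (resp. ε̈_{i-1} x), and nonnegativity together with the last clause
-- of LQ2 makes the remaining value strictly positive.

open import Defs
open import Data.Nat using (ℕ; zero; suc; pred; _<_; s≤s; _≟_)
open import Data.Nat using () renaming (∣_-_∣ to dist)
open import Data.Integer as ℤ using (ℤ; +_; -[1+_]; -_; _+_; _*_; _-_)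
open import Data.Maybe using (just)
open import Data.Product using (_×_; _,_; proj₁; proj₂)
open import Relation.Binary.PropositionalEquality using (_≡_)
open import Relation.Nullary using (¬_)
open import Level using (Level)

open import Algebra.Properties.AbelianGroup using (∙-cancelˡ)
open import Algebra.Properties.CommutativeSemigroup using (interchange)
open import Data.Fin as Fin using (Fin; toℕ)
open import Data.Integer.Properties
  using ( +-commutativeSemigroup; +-0-abelianGroup; +-assoc; +-comm; *-comm
        ; +-identityˡ; +-identityʳ; +-inverseʳ; *-zeroʳ; *-distribʳ-+; <-irrefl; ≤∧≢⇒< )
  renaming (_≟_ to _≟ℤ_)
open import Data.Nat.Properties using (suc-injective; ∣n-n∣≡0; ∣-∣-comm)
open import Data.Unit using (tt)
open import Function using (_∘_)
open import Relation.Binary.Definitions using (DecidableEquality)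
open import Relation.Binary.PropositionalEquality
  using (_≢_; _≗_; refl; sym; trans; cong; cong₂; subst; module ≡-Reasoning)
open import Relation.Nullary using (yes; no; contradiction)
open import Relation.Nullary.Decidable using (map′; decidable-stable)

sumFin-cong : ∀ {n} {f g : Fin n → ℤ} → f ≗ g → sumFin f ≡ sumFin g
sumFin-cong {zero}  f≗g = refl
sumFin-cong {suc n} f≗g = cong₂ _+_ (f≗g Fin.zero) (sumFin-cong (f≗g ∘ Fin.suc))

sumFin-+ : ∀ {n} (f g : Fin n → ℤ) → sumFin (λ k → f k + g k) ≡ sumFin f + sumFin g
sumFin-+ {zero}  f g = refl
sumFin-+ {suc n} f g =
  trans (cong (_+_ (f Fin.zero + g Fin.zero)) (sumFin-+ (f ∘ Fin.suc) (g ∘ Fin.suc)))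
        (interchange +-commutativeSemigroup (f Fin.zero) (g Fin.zero) _ _)

sumFin-zero : ∀ {n} {f : Fin n → ℤ} → (∀ k → f k ≡ + 0) → sumFin f ≡ + 0
sumFin-zero {zero}  f≡0 = refl
sumFin-zero {suc n} f≡0 = cong₂ _+_ (f≡0 Fin.zero) (sumFin-zero (f≡0 ∘ Fin.suc))

sumFin-single : ∀ {n} (g : ℕ → ℤ) {m} → m < n → (∀ k → k ≢ m → g k ≡ + 0) →
                sumFin {n} (λ k → g (toℕ k)) ≡ g m
sumFin-single {suc n} g {zero} _ g≡0 =
  trans (cong (_+_ (g 0)) (sumFin-zero {n} (λ k → g≡0 (suc (toℕ k)) λ ())))
        (+-identityʳ (g 0))
sumFin-single {suc n} g {suc m} (s≤s m<n) g≡0 =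
  trans (cong₂ _+_ (g≡0 0 λ ())
                    (sumFin-single (g ∘ suc) m<n λ k k≢m → g≡0 (suc k) (k≢m ∘ suc-injective)))
        (+-identityˡ (g (suc m)))

⟨,⟩-distribˡ-+w : ∀ {n} (v a u : Weight n) → ⟨ v +w a , u ⟩ ≡ ⟨ v , u ⟩ + ⟨ a , u ⟩
⟨,⟩-distribˡ-+w v a u =
  trans (sumFin-cong λ k → *-distribʳ-+ (u k) (v k) (a k))
        (sumFin-+ (λ k → v k * u k) (λ k → a k * u k))

⟨,⟩-comm : ∀ {n} (v u : Weight n) → ⟨ v , u ⟩ ≡ ⟨ u , v ⟩
⟨,⟩-comm v u = sumFin-cong λ k → *-comm (v k) (u k)

-- Opaque, so that a later `with m ≟ i` cannot abstract over the test hidden inside δ.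
opaque
  δ : ℕ → ℕ → ℤ
  δ a b with a ≟ b
  ... | yes _ = + 1
  ... | no _  = + 0

  δ-refl : ∀ a → δ a a ≡ + 1
  δ-refl a with a ≟ a
  ... | yes _  = refl
  ... | no a≢a = contradiction refl a≢a

  δ-≢ : ∀ {a b} → a ≢ b → δ a b ≡ + 0
  δ-≢ {a} {b} a≢b with a ≟ b
  ... | yes a≡b = contradiction a≡b a≢b
  ... | no _    = refl

  e-δ : ∀ {n} i (k : Fin n) → e i k ≡ δ (suc (toℕ k)) i
  e-δ i k with suc (toℕ k) ≟ i
  ... | yes _ = refl
  ... | no _  = refl

-- α′ i m is the m-th coordinate of α_i, counted from 1 as in the definition of e.
α′ : ℕ → ℕ → ℤ
α′ i m = δ m i - δ m (suc i)

α-α′ : ∀ {n} i (k : Fin n) → α i k ≡ α′ i (suc (toℕ k))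
α-α′ i k = cong₂ _-_ (e-δ i k) (e-δ (suc i) k)

α′-outside : ∀ {i m} → m ≢ i → m ≢ suc i → α′ i m ≡ + 0
α′-outside m≢i m≢si rewrite δ-≢ m≢i | δ-≢ m≢si = refl

n≢1+n : ∀ {m} → m ≢ suc m
n≢1+n ()

n≢2+n : ∀ {m} → m ≢ suc (suc m)
n≢2+n ()

α′-next-at : ∀ i → α′ i (suc i) * α′ (suc i) (suc i) ≡ -[1+ 0 ]
α′-next-at i rewrite δ-≢ {suc i} {i} (n≢1+n ∘ sym) | δ-refl (suc i) | δ-≢ (n≢1+n {suc i}) = refl

α′-next-off : ∀ {i m} → m ≢ suc i → α′ i m * α′ (suc i) m ≡ + 0
α′-next-off {i} {m} m≢si with m ≟ i
... | yes refl = trans (cong (α′ i i *_) (α′-outside n≢1+n n≢2+n)) (*-zeroʳ (α′ i i))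
... | no m≢i   = cong (_* α′ (suc i) m) (α′-outside m≢i m≢si)

dist-suc : ∀ i → dist i (suc i) ≡ 1
dist-suc zero    = refl
dist-suc (suc i) = dist-suc i

far⇒≢ : ∀ {i j} → 1 < dist i j → i ≢ j
far⇒≢ {i} far refl = contradiction (subst (1 <_) (∣n-n∣≡0 i) far) λ ()

far⇒≢suc : ∀ {i j} → 1 < dist i j → suc i ≢ j
far⇒≢suc {i} far refl = contradiction (subst (1 <_) (dist-suc i) far) λ { (s≤s ()) }

α′-far : ∀ {i j} → 1 < dist i j → ∀ m → α′ i m * α′ j m ≡ + 0
α′-far {i} {j} far m with m ≟ i | m ≟ suc i
... | yes refl | _ =
  trans (cong (α′ i i *_) (α′-outside (far⇒≢ far) (far⇒≢suc far′ ∘ sym))) (*-zeroʳ (α′ i i))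
  where far′ = subst (1 <_) (∣-∣-comm i j) far
... | no _ | yes refl =
  trans (cong (α′ i (suc i) *_) (α′-outside (far⇒≢suc far) (far⇒≢ far ∘ suc-injective)))
        (*-zeroʳ (α′ i (suc i)))
... | no m≢i | no m≢si = cong (_* α′ j m) (α′-outside m≢i m≢si)

⟨α,α⟩-far : ∀ {n i j} → 1 < dist i j → ⟨ α {n} i , α j ⟩ ≡ + 0
⟨α,α⟩-far {n} {i} {j} far =
  sumFin-zero {n} λ k → trans (cong₂ _*_ (α-α′ i k) (α-α′ j k)) (α′-far far (suc (toℕ k)))

⟨α,α⟩-next : ∀ {n i} → i < n → ⟨ α {n} i , α (suc i) ⟩ ≡ -[1+ 0 ]
⟨α,α⟩-next {n} {i} i<n = begin
  ⟨ α {n} i , α (suc i) ⟩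
    ≡⟨ sumFin-cong {n} (λ k → cong₂ _*_ (α-α′ i k) (α-α′ (suc i) k)) ⟩
  sumFin {n} (λ k → g (toℕ k))
    ≡⟨ sumFin-single g i<n (λ m m≢i → α′-next-off (m≢i ∘ suc-injective)) ⟩
  α′ i (suc i) * α′ (suc i) (suc i)
    ≡⟨ α′-next-at i ⟩
  -[1+ 0 ] ∎
  where
  open ≡-Reasoning
  g : ℕ → ℤ
  g m = α′ i (suc m) * α′ (suc i) (suc m)

fin-injective : ∀ {a b} → fin a ≡ fin b → a ≡ b
fin-injective refl = refl

_≟∞_ : DecidableEquality ℤ∞
fin a ≟∞ fin b = map′ (cong fin) fin-injective (a ≟ℤ b)
+∞    ≟∞ +∞    = yes refl
-∞    ≟∞ -∞    = yes refl
fin _ ≟∞ +∞    = no λ ()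
fin _ ≟∞ -∞    = no λ ()
+∞    ≟∞ fin _ = no λ ()
+∞    ≟∞ -∞    = no λ ()
-∞    ≟∞ fin _ = no λ ()
-∞    ≟∞ +∞    = no λ ()

≡∞-stable : ∀ {a b : ℤ∞} → ¬ ¬ a ≡ b → a ≡ b
≡∞-stable {a} {b} = decidable-stable (a ≟∞ b)

⊕-assoc : ∀ a b z → (a + b) ⊕ z ≡ a ⊕ (b ⊕ z)
⊕-assoc a b (fin k) = cong fin (+-assoc a b k)
⊕-assoc a b +∞      = refl
⊕-assoc a b -∞      = refl

⊕-cancelˡ : ∀ a {z z′} → a ⊕ z ≡ a ⊕ z′ → z ≡ z′
⊕-cancelˡ a {fin k} {fin k′} eq = cong fin (∙-cancelˡ +-0-abelianGroup a k k′ (fin-injective eq))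
⊕-cancelˡ a {+∞}    {+∞}     _  = refl
⊕-cancelˡ a { -∞}   { -∞}    _  = refl
⊕-cancelˡ a {fin _} {+∞}     ()
⊕-cancelˡ a {fin _} { -∞}    ()
⊕-cancelˡ a {+∞}    {fin _}  ()
⊕-cancelˡ a {+∞}    { -∞}    ()
⊕-cancelˡ a { -∞}   {fin _}  ()
⊕-cancelˡ a { -∞}   {+∞}     ()

Pos∞⇒≢0 : ∀ {z} → Pos∞ z → z ≢ fin (+ 0)
Pos∞⇒≢0 0<0 refl = <-irrefl refl 0<0

NonNeg∞∧≢0⇒Pos∞ : ∀ {z} → NonNeg∞ z → z ≢ fin (+ 0) → Pos∞ z
NonNeg∞∧≢0⇒Pos∞ {fin k} 0≤k z≢0 = ≤∧≢⇒< 0≤k (z≢0 ∘ cong fin ∘ sym)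
NonNeg∞∧≢0⇒Pos∞ {+∞}    _   _   = tt

module QuasiCrystalProperties {n ℓ} (Q : QuasiCrystal n ℓ) where
  open QuasiCrystal Q
  open ≡-Reasoning

  ε̈-+∞⇒φ̈-+∞ : ∀ {j z} → InI n j → ε̈ j z ≡ +∞ → φ̈ j z ≡ +∞
  ε̈-+∞⇒φ̈-+∞ {j} {z} jI ε≡∞ = trans (Q2 jI z) (cong (⟨ wt z , α j ⟩ ⊕_) ε≡∞)

  φ̈-+∞⇒ε̈-+∞ : ∀ {j z} → InI n j → φ̈ j z ≡ +∞ → ε̈ j z ≡ +∞
  φ̈-+∞⇒ε̈-+∞ {j} {z} jI φ≡∞ = ⊕-cancelˡ ⟨ wt z , α j ⟩ (trans (sym (Q2 jI z)) φ≡∞)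

  ⟨wt,α⟩-ë : ∀ {i x y} → InI n i → ë i x ≡ just y →
             ∀ j → ⟨ wt y , α j ⟩ ≡ ⟨ wt x , α j ⟩ + ⟨ α {n} i , α j ⟩
  ⟨wt,α⟩-ë {i} {x} {y} iI x→y j =
    trans (cong ⟨_, α j ⟩ (Q1-wt iI x y x→y)) (⟨,⟩-distribˡ-+w (wt x) (α i) (α j))

  ë-far : LQ2 Q → ∀ {i j x y} → InI n i → InI n j → 1 < dist i j → ë i x ≡ just y →
          (ε̈ j y ≡ ε̈ j x) × (φ̈ j y ≡ φ̈ j x)
  ë-far lq2 {i} {j} {x} {y} iI jI far x→y = ε≡ , (begin
    φ̈ j y                   ≡⟨ Q2 jI y ⟩
    ⟨ wt y , α j ⟩ ⊕ ε̈ j y  ≡⟨ cong₂ _⊕_ ⟨wt,α⟩≡ ε≡ ⟩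
    ⟨ wt x , α j ⟩ ⊕ ε̈ j x  ≡⟨ Q2 jI x ⟨
    φ̈ j x                   ∎)
    where
    ε≡ : ε̈ j y ≡ ε̈ j x
    ε≡ = sym (proj₁ (lq2 i iI x y x→y) j jI far)
    ⟨wt,α⟩≡ : ⟨ wt y , α j ⟩ ≡ ⟨ wt x , α j ⟩
    ⟨wt,α⟩≡ = begin
      ⟨ wt y , α j ⟩                     ≡⟨ ⟨wt,α⟩-ë iI x→y j ⟩
      ⟨ wt x , α j ⟩ + ⟨ α {n} i , α j ⟩ ≡⟨ cong (_+_ ⟨ wt x , α j ⟩) (⟨α,α⟩-far {n} {i} far) ⟩
      ⟨ wt x , α j ⟩ + + 0               ≡⟨ +-identityʳ _ ⟩
      ⟨ wt x , α j ⟩                     ∎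

  ⟨wt,α⟩-ë-next : ∀ {i x y} → InI n i → ë i x ≡ just y →
                  ⟨ wt y , α (suc i) ⟩ ≡ ⟨ wt x , α (suc i) ⟩ + -[1+ 0 ]
  ⟨wt,α⟩-ë-next {i} {x} iI x→y =
    trans (⟨wt,α⟩-ë iI x→y (suc i))
          (cong (_+_ ⟨ wt x , α (suc i) ⟩) (⟨α,α⟩-next {n} {i} (proj₂ iI)))

  ⟨wt,α⟩-ë-prev : ∀ {p x y} → InI n (suc p) → InI n p → ë (suc p) x ≡ just y →
                  ⟨ wt y , α p ⟩ ≡ ⟨ wt x , α p ⟩ + -[1+ 0 ]
  ⟨wt,α⟩-ë-prev {p} {x} iI pI x→y =
    trans (⟨wt,α⟩-ë iI x→y p)
          (cong (_+_ ⟨ wt x , α p ⟩)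
                (trans (⟨,⟩-comm (α {n} (suc p)) (α p)) (⟨α,α⟩-next {n} {p} (proj₂ pI))))

  ε̈-next-unchanged : LQ2 Q → ∀ {i x y} → InI n i → InI n (suc i) → ë i x ≡ just y →
                     ¬ (ε̈ (suc i) x ≡ +∞ × ε̈ i y ≡ fin (+ 0)) → ε̈ (suc i) y ≡ ε̈ (suc i) x
  ε̈-next-unchanged lq2 {i} {x} {y} iI sI x→y ¬jump =
    sym (≡∞-stable λ changed → ¬jump (proj₁ (proj₁ (proj₂ (lq2 i iI x y x→y)) sI) changed))

  φ̈-prev-unchanged : LQ2 Q → ∀ {p x y} → InI n (suc p) → InI n p → ë (suc p) x ≡ just y →
                     ¬ (φ̈ p y ≡ +∞ × φ̈ (suc p) x ≡ fin (+ 0)) → φ̈ p x ≡ φ̈ p y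
  φ̈-prev-unchanged lq2 {p} {x} {y} iI pI x→y ¬jump =
    ≡∞-stable λ changed → ¬jump (proj₁ (proj₂ (proj₂ (lq2 (suc p) iI x y x→y)) pI) changed)

  ë-next-finite : LQ2 Q → ∀ {i x y} → InI n i → InI n (suc i) → ë i x ≡ just y →
                  ε̈ (suc i) x ≢ +∞ →
                  (ε̈ (suc i) y ≡ ε̈ (suc i) x) × (φ̈ (suc i) y ≡ -[1+ 0 ] ⊕ φ̈ (suc i) x)
  ë-next-finite lq2 {i} {x} {y} iI sI x→y εx≢∞ = ε≡ , (begin
    φ̈ s y                          ≡⟨ Q2 sI y ⟩
    ⟨ wt y , α s ⟩ ⊕ ε̈ s y         ≡⟨ cong₂ _⊕_ (⟨wt,α⟩-ë-next iI x→y) ε≡ ⟩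
    (w + -[1+ 0 ]) ⊕ ε̈ s x         ≡⟨ cong (_⊕ ε̈ s x) (+-comm w -[1+ 0 ]) ⟩
    (-[1+ 0 ] + w) ⊕ ε̈ s x         ≡⟨ ⊕-assoc -[1+ 0 ] w (ε̈ s x) ⟩
    -[1+ 0 ] ⊕ (w ⊕ ε̈ s x)         ≡⟨ cong (-[1+ 0 ] ⊕_) (Q2 sI x) ⟨
    -[1+ 0 ] ⊕ φ̈ s x               ∎)
    where
    s = suc i
    w = ⟨ wt x , α s ⟩
    ε≡ : ε̈ s y ≡ ε̈ s x
    ε≡ = ε̈-next-unchanged lq2 iI sI x→y (εx≢∞ ∘ proj₁)

  ë-next-+∞-pos : LQ2 Q → ∀ {i x y} → InI n i → InI n (suc i) → ë i x ≡ just y →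
                  ε̈ (suc i) x ≡ +∞ → Pos∞ (ε̈ i y) →
                  (ε̈ (suc i) y ≡ +∞) × (ε̈ (suc i) x ≡ +∞) ×
                  (φ̈ (suc i) y ≡ +∞) × (φ̈ (suc i) x ≡ +∞)
  ë-next-+∞-pos lq2 iI sI x→y εx≡∞ pos =
    εy≡∞ , εx≡∞ , ε̈-+∞⇒φ̈-+∞ sI εy≡∞ , ε̈-+∞⇒φ̈-+∞ sI εx≡∞
    where
    εy≡∞ = trans (ε̈-next-unchanged lq2 iI sI x→y (Pos∞⇒≢0 pos ∘ proj₂)) εx≡∞

  ë-next-+∞-zero : LQ1 Q → LQ2 Q → NonNegValued Q →
                   ∀ {i x y} → InI n i → InI n (suc i) → ë i x ≡ just y →
                   ε̈ (suc i) x ≡ +∞ → ε̈ i y ≡ fin (+ 0) →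
                   (ε̈ (suc i) y ≡ fin (- ⟨ wt y , α (suc i) ⟩)) ×
                   (+ 0 ℤ.< - ⟨ wt y , α (suc i) ⟩) ×
                   (φ̈ (suc i) y ≡ fin (+ 0))
  ë-next-+∞-zero lq1 lq2 nonneg {i} {x} {y} iI sI x→y εx≡∞ εy≡0 =
    εy≡ , subst Pos∞ εy≡ (NonNeg∞∧≢0⇒Pos∞ (proj₁ (nonneg s sI y)) εy≢0) , φy≡0
    where
    s = suc i
    w = ⟨ wt y , α s ⟩
    φy≡0 : φ̈ s y ≡ fin (+ 0)
    φy≡0 = proj₁ (lq1 i iI sI y) εy≡0
    εy≡ : ε̈ s y ≡ fin (- w)
    εy≡ = ⊕-cancelˡ w (begin
      w ⊕ ε̈ s y      ≡⟨ Q2 sI y ⟨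
      φ̈ s y          ≡⟨ φy≡0 ⟩
      fin (+ 0)      ≡⟨ cong fin (+-inverseʳ w) ⟨
      w ⊕ fin (- w)  ∎)
    εy≢0 : ε̈ s y ≢ fin (+ 0)
    εy≢0 = let (_ , jump⇒changed , changed⇒≢0) = proj₁ (proj₂ (lq2 i iI x y x→y)) sI
           in changed⇒≢0 (jump⇒changed (εx≡∞ , εy≡0))

  ë-prev-finite : LQ2 Q → ∀ {p x y} → InI n (suc p) → InI n p → ë (suc p) x ≡ just y →
                  φ̈ p y ≢ +∞ →
                  (ε̈ p x ≡ -[1+ 0 ] ⊕ ε̈ p y) × (φ̈ p x ≡ φ̈ p y)
  ë-prev-finite lq2 {p} {x} {y} iI pI x→y φy≢∞ = ⊕-cancelˡ w (begin
    w ⊕ ε̈ p x                  ≡⟨ Q2 pI x ⟨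
    φ̈ p x                      ≡⟨ φ≡ ⟩
    φ̈ p y                      ≡⟨ Q2 pI y ⟩
    ⟨ wt y , α p ⟩ ⊕ ε̈ p y     ≡⟨ cong (_⊕ ε̈ p y) (⟨wt,α⟩-ë-prev iI pI x→y) ⟩
    (w + -[1+ 0 ]) ⊕ ε̈ p y     ≡⟨ ⊕-assoc w -[1+ 0 ] (ε̈ p y) ⟩
    w ⊕ (-[1+ 0 ] ⊕ ε̈ p y)     ∎) , φ≡
    where
    w = ⟨ wt x , α p ⟩
    φ≡ : φ̈ p x ≡ φ̈ p y
    φ≡ = φ̈-prev-unchanged lq2 iI pI x→y (φy≢∞ ∘ proj₁)

  ë-prev-+∞-pos : LQ2 Q → ∀ {p x y} → InI n (suc p) → InI n p → ë (suc p) x ≡ just y →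
                  φ̈ p y ≡ +∞ → Pos∞ (φ̈ (suc p) x) →
                  (ε̈ p x ≡ +∞) × (ε̈ p y ≡ +∞) × (φ̈ p x ≡ +∞) × (φ̈ p y ≡ +∞)
  ë-prev-+∞-pos lq2 iI pI x→y φy≡∞ pos =
    φ̈-+∞⇒ε̈-+∞ pI φx≡∞ , φ̈-+∞⇒ε̈-+∞ pI φy≡∞ , φx≡∞ , φy≡∞
    where
    φx≡∞ = trans (φ̈-prev-unchanged lq2 iI pI x→y (Pos∞⇒≢0 pos ∘ proj₂)) φy≡∞

  ë-prev-+∞-zero : LQ1 Q → LQ2 Q → NonNegValued Q →
                   ∀ {p x y} → InI n (suc p) → InI n p → ë (suc p) x ≡ just y →
                   φ̈ p y ≡ +∞ → φ̈ (suc p) x ≡ fin (+ 0) →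
                   (ε̈ p x ≡ fin (+ 0)) × (φ̈ p x ≡ fin ⟨ wt x , α p ⟩) × (+ 0 ℤ.< ⟨ wt x , α p ⟩)
  ë-prev-+∞-zero lq1 lq2 nonneg {p} {x} {y} iI pI x→y φy≡∞ φx≡0 =
    εx≡0 , φx≡ , subst Pos∞ φx≡ (NonNeg∞∧≢0⇒Pos∞ (proj₂ (nonneg p pI x)) φx≢0)
    where
    w = ⟨ wt x , α p ⟩
    εx≡0 : ε̈ p x ≡ fin (+ 0)
    εx≡0 = proj₂ (lq1 p pI iI x) φx≡0
    φx≡ : φ̈ p x ≡ fin w
    φx≡ = trans (Q2 pI x) (trans (cong (w ⊕_) εx≡0) (cong fin (+-identityʳ w)))
    φx≢0 : φ̈ p x ≢ fin (+ 0)
    φx≢0 = let (_ , jump⇒changed , changed⇒≢0) = proj₂ (proj₂ (lq2 (suc p) iI x y x→y)) pI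
           in changed⇒≢0 (jump⇒changed (φy≡∞ , φx≡0))

proposition3p4 : ∀ {n : ℕ} {ℓ : Level} → 2 Data.Nat.≤ n → (Q : QuasiCrystal n ℓ) →
    LQ1 Q → LQ2 Q → NonNegValued Q →
    let open QuasiCrystal Q in
    ∀ i → InI n i → ∀ x y → ë i x ≡ just y →
      -- (1)
      (∀ j → InI n j → 1 < dist i j →
        (ε̈ j y ≡ ε̈ j x) × (φ̈ j y ≡ φ̈ j x)) ×
      -- (2) j = i + 1
      (InI n (suc i) →
        -- (a)
        (¬ ε̈ (suc i) x ≡ +∞ →
          (ε̈ (suc i) y ≡ ε̈ (suc i) x) × (φ̈ (suc i) y ≡ -[1+ 0 ] ⊕ φ̈ (suc i) x)) ×
        -- (b)
        (ε̈ (suc i) x ≡ +∞ → Pos∞ (ε̈ i y) →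
          (ε̈ (suc i) y ≡ +∞) × (ε̈ (suc i) x ≡ +∞) ×
          (φ̈ (suc i) y ≡ +∞) × (φ̈ (suc i) x ≡ +∞)) ×
        -- (c)
        (ε̈ (suc i) x ≡ +∞ → ε̈ i y ≡ fin (+ 0) →
          (ε̈ (suc i) y ≡ fin (- ⟨ wt y , α (suc i) ⟩)) ×
          (+ 0 ℤ.< - ⟨ wt y , α (suc i) ⟩) ×
          (φ̈ (suc i) y ≡ fin (+ 0)))) ×
      -- (3) j = i - 1
      (InI n (pred i) →
        -- (a)
        (¬ φ̈ (pred i) y ≡ +∞ →
          (ε̈ (pred i) x ≡ -[1+ 0 ] ⊕ ε̈ (pred i) y) × (φ̈ (pred i) x ≡ φ̈ (pred i) y)) ×
        -- (b)
        (φ̈ (pred i) y ≡ +∞ → Pos∞ (φ̈ i x) →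
          (ε̈ (pred i) x ≡ +∞) × (ε̈ (pred i) y ≡ +∞) ×
          (φ̈ (pred i) x ≡ +∞) × (φ̈ (pred i) y ≡ +∞)) ×
        -- (c)
        (φ̈ (pred i) y ≡ +∞ → φ̈ i x ≡ fin (+ 0) →
          (ε̈ (pred i) x ≡ fin (+ 0)) ×
          (φ̈ (pred i) x ≡ fin ⟨ wt x , α (pred i) ⟩) ×
          (+ 0 ℤ.< ⟨ wt x , α (pred i) ⟩)))
proposition3p4 _ Q lq1 lq2 nonneg zero (() , _) x y x→y
proposition3p4 _ Q lq1 lq2 nonneg (suc p) iI x y x→y =
    (λ j jI far → ë-far lq2 iI jI far x→y)
  , (λ sI → ë-next-finite lq2 iI sI x→y
          , ë-next-+∞-pos lq2 iI sI x→y
          , ë-next-+∞-zero lq1 lq2 nonneg iI sI x→y)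
  , (λ pI → ë-prev-finite lq2 iI pI x→y
          , ë-prev-+∞-pos lq2 iI pI x→y
          , ë-prev-+∞-zero lq1 lq2 nonneg iI pI x→y)
  where open QuasiCrystalProperties Q
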